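{- Let $\gamma$ and $\delta$ be two interpolating EL-labellings of a finite bounded poset $P$. If $\gamma$ and $\delta$ agree on the edges of the $\gamma$-increasing chain from $\hat0$ to $\hat1$, then $\gamma=\delta$.
   Context: A poset is bounded if it has unique minimum $\hat0$ and maximum $\hat1$. An edge-labelling (map from covering relations to $\mathbb Z$) is an EL-labelling if for all $y<z$ there is a unique unrefinable chain from $y$ to $z$ with weakly increasing labels (the increasing chain), and its label sequence lexicographically precedes those of all other unrefinable chains from $y$ to $z$. It is interpolating if for every $y\lessdot u\lessdot z$, either $\gamma(y,u)<\gamma(u,z)$, or the increasing chain $y=w_0\lessdot\cdots\lessdot w_r=z$ has strictly increasing labels with $\gamma(w_0,w_1)=\gamma(u,z)$ and $\gamma(w_{r-1},w_r)=\gamma(y,u)$. -}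

module Defs where

open import Data.Nat using (ℕ)
open import Data.Fin using (Fin)
open import Data.Integer using (ℤ) renaming (_≤_ to _≤ℤ_; _<_ to _<ℤ_)
open import Data.List using (List; []; _∷_; _∷ʳ_)
open import Data.List.Relation.Unary.Linked using (Linked)
open import Data.List.Relation.Binary.Lex.Strict using (Lex-<)
open import Data.Product using (_×_; ∃; Σ)
open import Data.Sum using (_⊎_)
open import Relation.Binary.PropositionalEquality using (_≡_; _≢_)
open import Relation.Binary.Structures using (IsPartialOrder)
open import Relation.Nullary using (¬_)

-- A finite poset is given by a carrier Fin n and a partial order _≤_ on it.
-- An edge-labelling is a function Fin n → Fin n → ℤ; only its values on
-- covering pairs are relevant.
module _ {n : ℕ} (_≤_ : Fin n → Fin n → Set) where

  _<_ : Fin n → Fin n → Set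
  x < y = (x ≤ y) × (x ≢ y)

  _⋖_ : Fin n → Fin n → Set
  x ⋖ y = (x < y) × (∀ z → ¬ ((x < z) × (z < y)))

  -- bounded: unique minimum and maximum (uniqueness follows from antisymmetry)
  IsBounded : Fin n → Fin n → Set
  IsBounded bot top = (∀ x → bot ≤ x) × (∀ x → x ≤ top)

  data Chain : Fin n → Fin n → Set where
    done : ∀ {y} → Chain y y
    step : ∀ {y u z} → y ⋖ u → Chain u z → Chain y z

  vertices : ∀ {y z} → Chain y z → List (Fin n)
  vertices {y} done = y ∷ []
  vertices {y} (step _ c) = y ∷ vertices c

  labels : (γ : Fin n → Fin n → ℤ) → ∀ {y z} → Chain y z → List ℤ
  labels γ done = []
  labels γ (step {y} {u} _ c) = γ y u ∷ labels γ c

  Increasing : (γ : Fin n → Fin n → ℤ) → ∀ {y z} → Chain y z → Set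
  Increasing γ c = Linked _≤ℤ_ (labels γ c)

  StrictlyIncreasing : (γ : Fin n → Fin n → ℤ) → ∀ {y z} → Chain y z → Set
  StrictlyIncreasing γ c = Linked _<ℤ_ (labels γ c)

  -- strict lexicographic order on label sequences (a proper prefix is smaller)
  LexLess : List ℤ → List ℤ → Set
  LexLess = Lex-< _≡_ _<ℤ_

  IsELLabelling : (Fin n → Fin n → ℤ) → Set
  IsELLabelling γ =
    ∀ y z → y < z →
      Σ (Chain y z) λ c →
        Increasing γ c
        × (∀ (c' : Chain y z) → Increasing γ c' → vertices c' ≡ vertices c)
        × (∀ (c' : Chain y z) → vertices c' ≢ vertices c →
             LexLess (labels γ c) (labels γ c'))

  IsInterpolating : (Fin n → Fin n → ℤ) → Set
  IsInterpolating γ =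
    ∀ y u z → y ⋖ u → u ⋖ z →
      (γ y u <ℤ γ u z)
      ⊎ (∀ (c : Chain y z) → Increasing γ c →
           StrictlyIncreasing γ c
           × ∃ (λ ls → labels γ c ≡ γ u z ∷ ls)
           × ∃ (λ ls → labels γ c ≡ ls ∷ʳ γ y u))

  AgreeOn : (γ δ : Fin n → Fin n → ℤ) → ∀ {y z} → Chain y z → Set
  AgreeOn γ δ done = Data.Unit.⊤
    where import Data.Unit
  AgreeOn γ δ (step {y} {u} _ c) = (γ y u ≡ δ y u) × AgreeOn γ δ c

{-# OPTIONS --safe #-}
module Submission where

-- Downward induction on y: if γ and δ agree on the γ-increasing chain from y
-- to 1̂, they agree on every cover of [y, 1̂]. For an atom u of [y, 1̂] one
-- shows, by induction on γ(y,u), that γ(y,u) = δ(y,u) and that γ and δ agree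
-- on the γ-increasing chain from u; the outer hypothesis at u does the rest.
-- If y ⋖ u followed by the increasing chain u ⋖ v ⋖ ⋯ is γ-increasing, it is
-- the increasing chain from y. Otherwise γ(y,u) > γ(u,v), and by interpolation
-- the γ-increasing chain from y to v is strictly increasing, starts with
-- γ(u,v) and ends with γ(y,u). Its first atom has a smaller label than u, so
-- by both inductions γ = δ along it; it is then δ-increasing too, and
-- δ-interpolation at y ⋖ u ⋖ v forces δ(y,u) = γ(y,u) and δ(u,v) = γ(u,v).

open import Defs
open import Data.Nat using (ℕ)
open import Data.Fin using (Fin; _≟_)
open import Data.Fin.Induction using (po-noetherian; spo-wellFounded)
open import Data.Integer using (ℤ) renaming (_≤_ to _≤ℤ_; _<_ to _<ℤ_)
import Data.Integer.Properties as ℤ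
open import Data.List using ([]; _∷_; _∷ʳ_; zipWith; drop)
open import Data.List.Properties using (∷-injective; ∷-injectiveˡ; ∷ʳ-injectiveʳ)
open import Data.List.Relation.Unary.Linked as Linked using (Linked; []; [-]; _∷_)
open import Data.Product using (Σ; ∃; _×_; _,_; proj₁; proj₂)
open import Data.Sum using (inj₁; inj₂)
open import Data.Unit using (tt)
open import Function using (_on_)
open import Induction.WellFounded using (WellFounded; module All)
import Relation.Binary.Construct.On as On
open import Relation.Binary.PropositionalEquality
open import Relation.Binary.Structures using (IsPartialOrder)
open import Relation.Nullary using (yes; no; contradiction)

module _ {n : ℕ} {_≤_ : Fin n → Fin n → Set} (isPO : IsPartialOrder _≡_ _≤_) where

  open IsPartialOrder isPO using (antisym) renaming (refl to ≤-refl; trans to ≤-trans)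

  private
    _<ᴾ_ _⋖ᴾ_ : Fin n → Fin n → Set
    _<ᴾ_ = _<_ _≤_
    _⋖ᴾ_ = _⋖_ _≤_

  ⋖⇒≤ : ∀ {a b} → a ⋖ᴾ b → a ≤ b
  ⋖⇒≤ ((a≤b , _) , _) = a≤b

  chain⇒≤ : ∀ {a b} → Chain _≤_ a b → a ≤ b
  chain⇒≤ done = ≤-refl
  chain⇒≤ (step a⋖u c) = ≤-trans (⋖⇒≤ a⋖u) (chain⇒≤ c)

  vertices-loop : ∀ {a} (c : Chain _≤_ a a) → vertices _≤_ c ≡ a ∷ []
  vertices-loop done = refl
  vertices-loop (step ((a≤u , a≢u) , _) c) = contradiction (antisym a≤u (chain⇒≤ c)) a≢u

  vertices-head : ∀ {a b} (c : Chain _≤_ a b) → ∃ λ vs → vertices _≤_ c ≡ a ∷ vs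
  vertices-head done = [] , refl
  vertices-head (step _ c) = vertices _≤_ c , refl

  first-cover : ∀ {a b} → Chain _≤_ a b → a ≢ b → ∃ λ u → a ⋖ᴾ u × u ≤ b
  first-cover done a≢a = contradiction refl a≢a
  first-cover (step a⋖u c) _ = _ , a⋖u , chain⇒≤ c

  labels-by-vertices : ∀ γ {a b} (c : Chain _≤_ a b) →
    labels _≤_ γ c ≡ zipWith γ (vertices _≤_ c) (drop 1 (vertices _≤_ c))
  labels-by-vertices γ done = refl
  labels-by-vertices γ (step {y} {u} _ c)
    with vertices _≤_ c | vertices-head c | labels-by-vertices γ c
  ... | _ | _ , refl | ih = cong (γ y u ∷_) ih

  labels-cong : ∀ γ {a b} (c c′ : Chain _≤_ a b) →
    vertices _≤_ c ≡ vertices _≤_ c′ → labels _≤_ γ c ≡ labels _≤_ γ c′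
  labels-cong γ c c′ eq = begin
    labels _≤_ γ c                                            ≡⟨ labels-by-vertices γ c ⟩
    zipWith γ (vertices _≤_ c) (drop 1 (vertices _≤_ c))      ≡⟨ cong (λ vs → zipWith γ vs (drop 1 vs)) eq ⟩
    zipWith γ (vertices _≤_ c′) (drop 1 (vertices _≤_ c′))    ≡⟨ labels-by-vertices γ c′ ⟨
    labels _≤_ γ c′                                           ∎
    where open ≡-Reasoning

  module _ {γ δ : Fin n → Fin n → ℤ} where

    AgreeOn⇒labels≡ : ∀ {a b} (c : Chain _≤_ a b) →
      AgreeOn _≤_ γ δ c → labels _≤_ γ c ≡ labels _≤_ δ c
    AgreeOn⇒labels≡ done _ = refl
    AgreeOn⇒labels≡ (step _ c) (eq , agree) = cong₂ _∷_ eq (AgreeOn⇒labels≡ c agree)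

    labels≡⇒AgreeOn : ∀ {a b} (c : Chain _≤_ a b) →
      labels _≤_ γ c ≡ labels _≤_ δ c → AgreeOn _≤_ γ δ c
    labels≡⇒AgreeOn done _ = tt
    labels≡⇒AgreeOn (step _ c) eq =
      proj₁ (∷-injective eq) , labels≡⇒AgreeOn c (proj₂ (∷-injective eq))

    AgreeOn-cong : ∀ {a b} {c c′ : Chain _≤_ a b} →
      vertices _≤_ c ≡ vertices _≤_ c′ → AgreeOn _≤_ γ δ c → AgreeOn _≤_ γ δ c′
    AgreeOn-cong {c = c} {c′} eq agree = labels≡⇒AgreeOn c′ (begin
      labels _≤_ γ c′  ≡⟨ labels-cong γ c c′ eq ⟨
      labels _≤_ γ c   ≡⟨ AgreeOn⇒labels≡ c agree ⟩
      labels _≤_ δ c   ≡⟨ labels-cong δ c c′ eq ⟩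
      labels _≤_ δ c′  ∎)
      where open ≡-Reasoning

    AgreeOn-StrictlyIncreasing⇒Increasing : ∀ {a b} (c : Chain _≤_ a b) →
      AgreeOn _≤_ γ δ c → StrictlyIncreasing _≤_ γ c → Increasing _≤_ δ c
    AgreeOn-StrictlyIncreasing⇒Increasing c agree c↑ =
      subst (Linked _≤ℤ_) (AgreeOn⇒labels≡ c agree) (Linked.map ℤ.<⇒≤ c↑)

  module _ {γ : Fin n → Fin n → ℤ} (γ-EL : IsELLabelling _≤_ γ) where

    increasingChain : ∀ {a b} → a ≤ b → Σ (Chain _≤_ a b) (Increasing _≤_ γ)
    increasingChain {a} {b} a≤b with a ≟ b
    ... | yes refl = done , []
    ... | no a≢b = let c , c↑ , _ = γ-EL a b (a≤b , a≢b) in c , c↑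

    increasing-unique : ∀ {a b} (c c′ : Chain _≤_ a b) →
      Increasing _≤_ γ c → Increasing _≤_ γ c′ → vertices _≤_ c ≡ vertices _≤_ c′
    increasing-unique {a} {b} c c′ c↑ c′↑ with a ≟ b
    ... | yes refl = trans (vertices-loop c) (sym (vertices-loop c′))
    ... | no a≢b =
      let _ , _ , unique , _ = γ-EL a b (chain⇒≤ c , a≢b)
      in trans (unique c c↑) (sym (unique c′ c′↑))

  module _ {γ δ : Fin n → Fin n → ℤ}
           (γ-EL : IsELLabelling _≤_ γ) (γ-int : IsInterpolating _≤_ γ)
           (δ-EL : IsELLabelling _≤_ δ) (δ-int : IsInterpolating _≤_ δ) where

    agree-at-descent : ∀ {y u v} → y ⋖ᴾ u → u ⋖ᴾ v → γ u v <ℤ γ y u →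
      (w : Chain _≤_ y v) → StrictlyIncreasing _≤_ γ w → AgreeOn _≤_ γ δ w →
      ∃ (λ ls → labels _≤_ γ w ≡ γ u v ∷ ls) → ∃ (λ ls → labels _≤_ γ w ≡ ls ∷ʳ γ y u) →
      γ y u ≡ δ y u × γ u v ≡ δ u v
    agree-at-descent {y} {u} {v} y⋖u u⋖v descent w w↑ agree (ls , γ-first) (ls′ , γ-last)
      with δ-int y u v y⋖u u⋖v
    ... | inj₁ δ-ascent = contradiction (Linked.head γ-yuv↑) (ℤ.<-asym descent)
      where
      yuv : Chain _≤_ y v
      yuv = step y⋖u (step u⋖v done)
      w≈yuv : vertices _≤_ w ≡ vertices _≤_ yuv
      w≈yuv = increasing-unique δ-EL w yuv
        (AgreeOn-StrictlyIncreasing⇒Increasing w agree w↑) (ℤ.<⇒≤ δ-ascent ∷ [-])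
      γ-yuv↑ : StrictlyIncreasing _≤_ γ yuv
      γ-yuv↑ = subst (Linked _<ℤ_) (labels-cong γ w yuv w≈yuv) w↑
    ... | inj₂ δ-interpolates
      with δ-interpolates w (AgreeOn-StrictlyIncreasing⇒Increasing w agree w↑)
    ... | _ , (ms , δ-first) , (ms′ , δ-last) =
      ∷ʳ-injectiveʳ ls′ ms′ (trans (sym γ-last) (trans labels≡ δ-last)) ,
      ∷-injectiveˡ (trans (sym γ-first) (trans labels≡ δ-first))
      where
      labels≡ : labels _≤_ γ w ≡ labels _≤_ δ w
      labels≡ = AgreeOn⇒labels≡ w agree

    module _ (top : Fin n) where

      AgreeOnIncreasingFrom : Fin n → Set
      AgreeOnIncreasingFrom y =
        ∀ (c : Chain _≤_ y top) → Increasing _≤_ γ c → AgreeOn _≤_ γ δ c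

      AgreeAbove : Fin n → Set
      AgreeAbove y = ∀ a b → y ≤ a → b ≤ top → a ⋖ᴾ b → γ a b ≡ δ a b

      AgreeAbove⇒AgreeOn : ∀ {y a b} → AgreeAbove y → y ≤ a → b ≤ top →
        (c : Chain _≤_ a b) → AgreeOn _≤_ γ δ c
      AgreeAbove⇒AgreeOn above y≤a b≤top done = tt
      AgreeAbove⇒AgreeOn above y≤a b≤top (step a⋖u c) =
        above _ _ y≤a (≤-trans (chain⇒≤ c) b≤top) a⋖u ,
        AgreeAbove⇒AgreeOn above (≤-trans y≤a (⋖⇒≤ a⋖u)) b≤top c

      AgreeOn⇒AgreeOnIncreasingFrom : ∀ {u} (c : Chain _≤_ u top) →
        Increasing _≤_ γ c → AgreeOn _≤_ γ δ c → AgreeOnIncreasingFrom u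
      AgreeOn⇒AgreeOnIncreasingFrom c c↑ agree c′ c′↑ =
        AgreeOn-cong (increasing-unique γ-EL c c′ c↑ c′↑) agree

      module _ {y : Fin n}
               (agreeAbove-IH : ∀ {w} → y <ᴾ w → AgreeOnIncreasingFrom w → AgreeAbove w)
               (agree-y : AgreeOnIncreasingFrom y) where

        AtomAgrees : Fin n → Set
        AtomAgrees u = y ⋖ᴾ u → u ≤ top → γ y u ≡ δ y u × AgreeOnIncreasingFrom u

        atom-agrees-by-extension : ∀ {u} (y⋖u : y ⋖ᴾ u) (c : Chain _≤_ u top) →
          Increasing _≤_ γ c → Increasing _≤_ γ (step y⋖u c) →
          γ y u ≡ δ y u × AgreeOnIncreasingFrom u
        atom-agrees-by-extension y⋖u c c↑ yc↑ =
          let yu≡ , agree-c = agree-y (step y⋖u c) yc↑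
          in yu≡ , AgreeOn⇒AgreeOnIncreasingFrom c c↑ agree-c

        atom-agrees-at-descent : ∀ {u v} → (∀ {u′} → γ y u′ <ℤ γ y u → AtomAgrees u′) →
          (y⋖u : y ⋖ᴾ u) (u⋖v : u ⋖ᴾ v) (cv : Chain _≤_ v top) →
          Increasing _≤_ γ (step u⋖v cv) → γ u v <ℤ γ y u →
          γ y u ≡ δ y u × AgreeOnIncreasingFrom u
        atom-agrees-at-descent {u} {v} smaller y⋖u u⋖v cv c↑ descent
          with γ-int y u v y⋖u u⋖v
        ... | inj₁ ascent = contradiction ascent (ℤ.<-asym descent)
        ... | inj₂ γ-interpolates =
          let w , w↑ = increasingChain γ-EL (≤-trans (⋖⇒≤ y⋖u) (⋖⇒≤ u⋖v))
          in along w (γ-interpolates w w↑)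
          where
          v≤top : v ≤ top
          v≤top = chain⇒≤ cv
          along : (w : Chain _≤_ y v) →
            StrictlyIncreasing _≤_ γ w × ∃ (λ ls → labels _≤_ γ w ≡ γ u v ∷ ls)
                                       × ∃ (λ ls → labels _≤_ γ w ≡ ls ∷ʳ γ y u) →
            γ y u ≡ δ y u × AgreeOnIncreasingFrom u
          along done (_ , (_ , ()) , _)
          along (step {u = w₁} y⋖w₁ w′) (w↑ , first@(_ , w-first) , last) =
            let w₁-below = subst (_<ℤ γ y u) (sym (∷-injectiveˡ w-first)) descent
                yw₁≡ , w₁-agrees = smaller w₁-below y⋖w₁ (≤-trans (chain⇒≤ w′) v≤top)
                above-w₁ = agreeAbove-IH (proj₁ y⋖w₁) w₁-agrees
                agree-w = yw₁≡ , AgreeAbove⇒AgreeOn above-w₁ ≤-refl v≤top w′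
                yu≡ , uv≡ = agree-at-descent y⋖u u⋖v descent (step y⋖w₁ w′) w↑ agree-w first last
                agree-cv = AgreeAbove⇒AgreeOn above-w₁ (chain⇒≤ w′) ≤-refl cv
            in yu≡ , AgreeOn⇒AgreeOnIncreasingFrom (step u⋖v cv) c↑ (uv≡ , agree-cv)

        atom-agrees : ∀ u → AtomAgrees u
        atom-agrees = All.wfRec smaller-label-wellFounded _ AtomAgrees induction-step
          where
          smaller-label-wellFounded : WellFounded (_<ℤ_ on γ y)
          smaller-label-wellFounded = spo-wellFounded (On.isStrictPartialOrder (γ y) ℤ.<-isStrictPartialOrder)
          induction-step : ∀ u → (∀ {u′} → γ y u′ <ℤ γ y u → AtomAgrees u′) → AtomAgrees u
          induction-step u smaller y⋖u u≤top with increasingChain γ-EL u≤top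
          ... | done , [] = atom-agrees-by-extension y⋖u done [] [-]
          ... | step {u = v} u⋖v cv , c↑ with γ y u ℤ.≤? γ u v
          ... | yes ascent = atom-agrees-by-extension y⋖u (step u⋖v cv) c↑ (ascent ∷ c↑)
          ... | no ¬ascent = atom-agrees-at-descent smaller y⋖u u⋖v cv c↑ (ℤ.≰⇒> ¬ascent)

      agreeAbove : ∀ y → AgreeOnIncreasingFrom y → AgreeAbove y
      agreeAbove = All.wfRec (po-noetherian isPO) _
        (λ y → AgreeOnIncreasingFrom y → AgreeAbove y) induction-step
        where
        induction-step : ∀ y → (∀ {w} → y <ᴾ w → AgreeOnIncreasingFrom w → AgreeAbove w) →
          AgreeOnIncreasingFrom y → AgreeAbove y
        induction-step y IH agree-y a b y≤a b≤top a⋖b with y ≟ a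
        ... | yes refl = proj₁ (atom-agrees IH agree-y b a⋖b b≤top)
        ... | no y≢a with first-cover (proj₁ (increasingChain γ-EL y≤a)) y≢a
        ... | u , y⋖u , u≤a =
          IH (proj₁ y⋖u) (proj₂ (atom-agrees IH agree-y u y⋖u u≤top)) a b u≤a b≤top a⋖b
          where
          u≤top : u ≤ top
          u≤top = ≤-trans u≤a (≤-trans (⋖⇒≤ a⋖b) b≤top)

proposition2 : (n : ℕ) (_≤_ : Fin n → Fin n → Set) → IsPartialOrder _≡_ _≤_ →
    (bot top : Fin n) → IsBounded _≤_ bot top →
    (γ δ : Fin n → Fin n → ℤ) →
    IsELLabelling _≤_ γ → IsInterpolating _≤_ γ →
    IsELLabelling _≤_ δ → IsInterpolating _≤_ δ →
    (∀ (c : Chain _≤_ bot top) → Increasing _≤_ γ c → AgreeOn _≤_ γ δ c) →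
    ∀ x y → _⋖_ _≤_ x y → γ x y ≡ δ x y
proposition2 n _≤_ isPO bot top (bot≤ , ≤top) γ δ γ-EL γ-int δ-EL δ-int agree x y x⋖y =
  agreeAbove isPO γ-EL γ-int δ-EL δ-int top bot agree x y (bot≤ x) (≤top y) x⋖y
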